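{- Let $G=((X,Y),E)$ be a split graph with $\sigma(G)=2$ whose maximum degree $\Delta(G)$ is even, and let $v$ be a vertex with $d(v)=\Delta(G)$. If $G[N[v]]$ is overfull, then $v$ has no pendant neighbor, i.e. no neighbor of degree $1$.
   Context: All graphs are simple, finite, connected and undirected. A split graph $G=((X,Y),E)$ is a graph whose vertex set is partitioned into a clique $X$ and an independent set $Y$; $X$ is taken to be a maximal clique. For $t\ge 1$, a tree $t$-spanner of a connected graph $G$ is a spanning tree $T$ of $G$ such that $d_T(u,w)\le t$ for every edge $uw$ of $G$. The stretch index $\sigma(G)$ is the smallest $t$ for which $G$ admits a tree $t$-spanner. $N[v]=N(v)\cup\{v\}$ is the closed neighborhood of $v$, and $G[S]$ is the subgraph induced by $S$. A vertex of degree $1$ is called pendant. A graph $H$ is overfull if $|E(H)|>\Delta(H)\cdot\lfloor |V(H)|/2\rfloor$. -}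

module Defs where

open import Data.Nat using (ℕ; zero; suc; _+_; _*_; _≤_; _<_; _⊔_)
open import Data.Nat.DivMod using (_/_)
open import Data.Fin using (Fin; zero; suc; toℕ; inject₁; fromℕ)
open import Data.Bool using (Bool; true; false; if_then_else_; _∧_)
open import Data.Product using (Σ; ∃; _×_; _,_)
open import Relation.Binary.PropositionalEquality using (_≡_; _≢_)
open import Relation.Nullary using (¬_)
open import Function.Definitions using (Injective)

count : {n : ℕ} → (Fin n → Bool) → ℕ
count {zero}  p = 0
count {suc n} p = (if p zero then 1 else 0) + count (λ i → p (suc i))

sumFin : {n : ℕ} → (Fin n → ℕ) → ℕ
sumFin {zero}  f = 0
sumFin {suc n} f = f zero + sumFin (λ i → f (suc i))

maxFin : {n : ℕ} → (Fin n → ℕ) → ℕ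
maxFin {zero}  f = 0
maxFin {suc n} f = f zero ⊔ maxFin (λ i → f (suc i))

record Graph (n : ℕ) : Set where
  field
    adj   : Fin n → Fin n → Bool
    sym   : ∀ u w → adj u w ≡ adj w u
    irrefl : ∀ u → adj u u ≡ false
open Graph public

Adj : {n : ℕ} → Graph n → Fin n → Fin n → Set
Adj G u w = adj G u w ≡ true

deg : {n : ℕ} → Graph n → Fin n → ℕ
deg G v = count (adj G v)

Δ : {n : ℕ} → Graph n → ℕ
Δ G = maxFin (deg G)

-- walks with their length; d(u,w) ≤ t iff a walk of length ≤ t exists
data Walk {n : ℕ} (G : Graph n) : Fin n → Fin n → ℕ → Set where
  nil  : ∀ {u} → Walk G u u 0
  cons : ∀ {u x w k} → Adj G u x → Walk G x w k → Walk G u w (suc k)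

DistLe : {n : ℕ} → Graph n → Fin n → Fin n → ℕ → Set
DistLe G u w t = Σ ℕ (λ k → k ≤ t × Walk G u w k)

Connected : {n : ℕ} → Graph n → Set
Connected G = ∀ u w → Σ ℕ (λ k → Walk G u w k)

-- a cycle of length m+3: injective cyclic sequence of vertices
record Cycle {n : ℕ} (G : Graph n) : Set where
  field
    m     : ℕ
    vtx   : Fin (suc (suc (suc m))) → Fin n
    inj   : Injective _≡_ _≡_ vtx
    step  : ∀ (i : Fin (suc (suc m))) → Adj G (vtx (inject₁ i)) (vtx (suc i))
    close : Adj G (vtx (fromℕ (suc (suc m)))) (vtx zero)

Acyclic : {n : ℕ} → Graph n → Set
Acyclic G = ¬ Cycle G

IsTree : {n : ℕ} → Graph n → Set
IsTree G = Connected G × Acyclic G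

SpanningTree : {n : ℕ} → Graph n → Graph n → Set
SpanningTree G T = (∀ u w → Adj T u w → Adj G u w) × IsTree T

TreeSpanner : {n : ℕ} → Graph n → ℕ → Graph n → Set
TreeSpanner G t T = SpanningTree G T × (∀ u w → Adj G u w → DistLe T u w t)

HasTreeSpanner : {n : ℕ} → Graph n → ℕ → Set
HasTreeSpanner G t = Σ (Graph _) (TreeSpanner G t)

StretchIndex : {n : ℕ} → Graph n → ℕ → Set
StretchIndex G t = 1 ≤ t × HasTreeSpanner G t
                   × (∀ s → 1 ≤ s → s < t → ¬ HasTreeSpanner G s)

-- split graph with partition (X,Y): inX x = true iff x ∈ X
record SplitPartition {n : ℕ} (G : Graph n) (inX : Fin n → Bool) : Set where
  field
    clique    : ∀ x x' → inX x ≡ true → inX x' ≡ true → x ≢ x' → Adj G x x'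
    indep     : ∀ y y' → inX y ≡ false → inX y' ≡ false → ¬ Adj G y y'
    maximalX  : ∀ y → inX y ≡ false → Σ (Fin n) (λ x → inX x ≡ true × ¬ Adj G y x)

-- induced subgraph G[S] for S : Fin n → Bool, via its parameters
vertsIn : {n : ℕ} → (Fin n → Bool) → ℕ
vertsIn S = count S

degIn : {n : ℕ} → Graph n → (Fin n → Bool) → Fin n → ℕ
degIn G S u = count (λ w → S w ∧ adj G u w)

ΔIn : {n : ℕ} → Graph n → (Fin n → Bool) → ℕ
ΔIn G S = maxFin (λ u → if S u then degIn G S u else 0)

-- edges counted as ordered pairs (u,w) with toℕ u < toℕ w
ltB : ℕ → ℕ → Bool
ltB _ zero = false
ltB zero (suc _) = true
ltB (suc a) (suc b) = ltB a b

edgesIn : {n : ℕ} → Graph n → (Fin n → Bool) → ℕ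
edgesIn G S = sumFin (λ u → count (λ w → ltB (toℕ u) (toℕ w) ∧ (S u ∧ (S w ∧ adj G u w))))

OverfullIn : {n : ℕ} → Graph n → (Fin n → Bool) → Set
OverfullIn G S = ΔIn G S * (vertsIn S / 2) < edgesIn G S

closedNbhd : {n : ℕ} → Graph n → Fin n → Fin n → Bool
closedNbhd G v u = adj G v u Data.Bool.∨ eqB
  where
    open import Data.Fin using (_≟_)
    open import Relation.Nullary using (does)
    eqB = does (v ≟ u)

-- Write Δ = 2q and S = N[v], so |S| = 2q + 1 and G[S] has maximum degree at least d(v) = Δ.
-- Overfullness then gives e(G[S]) ≥ Δq + 1.  On the other hand, twice e(G[S]) is the degree
-- sum of G[S], in which every vertex contributes at most Δ and a pendant neighbour u of v
-- contributes only 1, so 2 e(G[S]) ≤ Δ(2q + 1) − (Δ − 1) = 2Δq + 1, i.e. e(G[S]) ≤ Δq.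
-- Neither the split structure nor the stretch index is needed.
module Submission where

open import Defs
open import Data.Nat using (ℕ)
open import Data.Nat.Divisibility using (_∣_)
open import Data.Fin using (Fin)
open import Data.Bool using (Bool)
open import Relation.Binary.PropositionalEquality using (_≡_; _≢_)

open import Data.Nat using (zero; suc; _+_; _*_; _∸_; _≤_; _<_; z≤n; s≤s)
open import Data.Nat.Properties
  using (≤-trans; ≤-reflexive; ≤-pred; n≤1+n; n≮n; <⇒≱; ≮⇒≥; +-mono-≤; +-monoˡ-≤; *-monoˡ-≤;
         +-cancelʳ-≤; +-suc; +-assoc; +-comm; m+[n∸m]≡n; *-identityʳ; *-zeroʳ; m≤m⊔n; m≤n⊔m;
         +-*-semiring; module ≤-Reasoning)
open import Data.Nat.DivMod using (_/_; +-distrib-/-∣ʳ; m*n/n≡m)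
open import Data.Nat.Divisibility using (divides; divides-refl)
open import Data.Nat.Tactic.RingSolver using (solve-∀)
open import Data.Fin using (zero; suc; toℕ; _≟_; punchIn)
open import Data.Fin.Properties using (toℕ-injective)
open import Data.Bool using (true; false; if_then_else_; _∧_; _∨_)
open import Data.Bool.Properties using (∧-assoc; ∧-comm; ∧-zeroʳ; ∧-abs-∨)
open import Data.Vec.Functional using (removeAt)
open import Function using (_∘_)
open import Relation.Binary.PropositionalEquality
  using (refl; trans; cong; cong₂; subst; _≗_; module ≡-Reasoning) renaming (sym to ≡-sym)
open import Relation.Nullary using (does; yes; no)
open import Data.Empty using (⊥-elim)
open import Algebra.Properties.Semiring.Sum +-*-semiring
  using (sum; sum-cong-≗; sum-remove; ∑-distrib-+; ∑-comm; *-distribˡ-sum)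

𝟙 : Bool → ℕ
𝟙 b = if b then 1 else 0

sumFin≡sum : ∀ {n} (f : Fin n → ℕ) → sumFin f ≡ sum f
sumFin≡sum {zero}  f = refl
sumFin≡sum {suc n} f = cong (f zero +_) (sumFin≡sum (f ∘ suc))

count≡sum𝟙 : ∀ {n} (p : Fin n → Bool) → count p ≡ sum (𝟙 ∘ p)
count≡sum𝟙 {zero}  p = refl
count≡sum𝟙 {suc n} p = cong (𝟙 (p zero) +_) (count≡sum𝟙 (p ∘ suc))

count-cong : ∀ {n} {p q : Fin n → Bool} → p ≗ q → count p ≡ count q
count-cong {p = p} {q} p≗q = begin
  count p      ≡⟨ count≡sum𝟙 p ⟩
  sum (𝟙 ∘ p)  ≡⟨ sum-cong-≗ (cong 𝟙 ∘ p≗q) ⟩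
  sum (𝟙 ∘ q)  ≡⟨ count≡sum𝟙 q ⟨
  count q      ∎
  where open ≡-Reasoning

count-mono : ∀ {n} {p q : Fin n → Bool} → (∀ i → p i ≡ true → q i ≡ true) → count p ≤ count q
count-mono {zero}          p⇒q = z≤n
count-mono {suc n} {p} {q} p⇒q with p zero | q zero | p⇒q zero
... | true  | true  | _     = s≤s (count-mono (p⇒q ∘ suc))
... | true  | false | p₀⇒q₀ with () ← p₀⇒q₀ refl
... | false | true  | _     = ≤-trans (count-mono (p⇒q ∘ suc)) (n≤1+n _)
... | false | false | _     = count-mono (p⇒q ∘ suc)

count-∨-disjoint : ∀ {n} (p q : Fin n → Bool) → (∀ i → p i ∧ q i ≡ false) →
                   count (λ i → p i ∨ q i) ≡ count p + count q
count-∨-disjoint p q disjoint = begin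
  count (λ i → p i ∨ q i)         ≡⟨ count≡sum𝟙 (λ i → p i ∨ q i) ⟩
  sum (λ i → 𝟙 (p i ∨ q i))       ≡⟨ sum-cong-≗ (λ i → 𝟙-∨ (p i) (q i) (disjoint i)) ⟩
  sum (λ i → 𝟙 (p i) + 𝟙 (q i))   ≡⟨ ∑-distrib-+ (𝟙 ∘ p) (𝟙 ∘ q) ⟩
  sum (𝟙 ∘ p) + sum (𝟙 ∘ q)       ≡⟨ cong₂ _+_ (count≡sum𝟙 p) (count≡sum𝟙 q) ⟨
  count p + count q               ∎
  where
  open ≡-Reasoning
  𝟙-∨ : ∀ a b → a ∧ b ≡ false → 𝟙 (a ∨ b) ≡ 𝟙 a + 𝟙 b
  𝟙-∨ true  true  ()
  𝟙-∨ true  false _ = refl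
  𝟙-∨ false b     _ = refl

count-false : ∀ {n} → count {n} (λ _ → false) ≡ 0
count-false {zero}  = refl
count-false {suc n} = count-false {n}

count-≟ : ∀ {n} (v : Fin n) → count (λ w → does (v ≟ w)) ≡ 1
count-≟ {suc n} zero    = cong suc (count-false {n})
count-≟ {suc n} (suc v) = trans (count-cong does-suc) (count-≟ v)
  where
  does-suc : ∀ w → does (suc v ≟ suc w) ≡ does (v ≟ w)
  does-suc w with v ≟ w
  ... | yes _ = refl
  ... | no  _ = refl

sum-if≡*count : ∀ {n} (c : ℕ) (p : Fin n → Bool) → sum (λ i → if p i then c else 0) ≡ c * count p
sum-if≡*count c p = begin
  sum (λ i → if p i then c else 0)  ≡⟨ sum-cong-≗ (λ i → ≡-sym (*-𝟙 (p i))) ⟩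
  sum (λ i → c * 𝟙 (p i))           ≡⟨ *-distribˡ-sum c (𝟙 ∘ p) ⟨
  c * sum (𝟙 ∘ p)                   ≡⟨ cong (c *_) (count≡sum𝟙 p) ⟨
  c * count p                       ∎
  where
  open ≡-Reasoning
  *-𝟙 : ∀ b → c * 𝟙 b ≡ (if b then c else 0)
  *-𝟙 true  = *-identityʳ c
  *-𝟙 false = *-zeroʳ c

sum-mono-≤ : ∀ {n} {f g : Fin n → ℕ} → (∀ i → f i ≤ g i) → sum f ≤ sum g
sum-mono-≤ {zero}  f≤g = z≤n
sum-mono-≤ {suc n} f≤g = +-mono-≤ (f≤g zero) (sum-mono-≤ (f≤g ∘ suc))

sum-mono-≤-slack : ∀ {n} {f g : Fin n → ℕ} {c : ℕ} (j : Fin n) →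
                   (∀ i → f i ≤ g i) → f j + c ≤ g j → sum f + c ≤ sum g
sum-mono-≤-slack {suc n} {f} {g} {c} j f≤g slack = begin
  sum f + c                           ≡⟨ cong (_+ c) (sum-remove f) ⟩
  f j + sum f∖j + c                   ≡⟨ +-assoc (f j) _ c ⟩
  f j + (sum f∖j + c)                 ≡⟨ cong (f j +_) (+-comm _ c) ⟩
  f j + (c + sum f∖j)                 ≡⟨ +-assoc (f j) c _ ⟨
  f j + c + sum f∖j                   ≤⟨ +-mono-≤ slack (sum-mono-≤ (f≤g ∘ punchIn j)) ⟩
  g j + sum (removeAt g j)            ≡⟨ sum-remove g ⟨
  sum g                               ∎
  where
  open ≤-Reasoning
  f∖j = removeAt f j

maxFin-upper : ∀ {n} (f : Fin n → ℕ) (i : Fin n) → f i ≤ maxFin f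
maxFin-upper f zero    = m≤m⊔n _ _
maxFin-upper f (suc i) = ≤-trans (maxFin-upper (f ∘ suc) i) (m≤n⊔m _ _)

ltB-irrefl : ∀ a → ltB a a ≡ false
ltB-irrefl zero    = refl
ltB-irrefl (suc a) = ltB-irrefl a

ltB-split : ∀ a b → a ≢ b → (x : Bool) → 𝟙 (ltB a b ∧ x) + 𝟙 (ltB b a ∧ x) ≡ 𝟙 x
ltB-split zero    zero    a≢b x     = ⊥-elim (a≢b refl)
ltB-split zero    (suc b) a≢b true  = refl
ltB-split zero    (suc b) a≢b false = refl
ltB-split (suc a) zero    a≢b true  = refl
ltB-split (suc a) zero    a≢b false = refl
ltB-split (suc a) (suc b) a≢b x     = ltB-split a b (a≢b ∘ cong suc) x

orderedPairCount : ∀ {n} → (Fin n → Fin n → Bool) → ℕ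
orderedPairCount A = sum (λ u → count (λ w → ltB (toℕ u) (toℕ w) ∧ A u w))

handshake : ∀ {n} (A : Fin n → Fin n → Bool) → (∀ u w → A u w ≡ A w u) → (∀ u → A u u ≡ false) →
            orderedPairCount A + orderedPairCount A ≡ sum (λ u → count (A u))
handshake A A-sym A-irrefl = begin
  orderedPairCount A + orderedPairCount A                          ≡⟨ cong₂ _+_ pairs≡ (trans pairs≡ (∑-comm f)) ⟩
  sum (λ u → sum (f u)) + sum (λ u → sum (λ w → f w u))            ≡⟨ ∑-distrib-+ (λ u → sum (f u)) _ ⟨
  sum (λ u → sum (f u) + sum (λ w → f w u))                        ≡⟨ sum-cong-≗ (λ u → ∑-distrib-+ (f u) _) ⟨
  sum (λ u → sum (λ w → f u w + f w u))                            ≡⟨ sum-cong-≗ (λ u → sum-cong-≗ (f-pair u)) ⟩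
  sum (λ u → sum (𝟙 ∘ A u))                                        ≡⟨ sum-cong-≗ (count≡sum𝟙 ∘ A) ⟨
  sum (λ u → count (A u))                                          ∎
  where
  open ≡-Reasoning
  f : Fin _ → Fin _ → ℕ
  f u w = 𝟙 (ltB (toℕ u) (toℕ w) ∧ A u w)

  pairs≡ : orderedPairCount A ≡ sum (λ u → sum (f u))
  pairs≡ = sum-cong-≗ (λ u → count≡sum𝟙 (λ w → ltB (toℕ u) (toℕ w) ∧ A u w))

  f-pair : ∀ u w → f u w + f w u ≡ 𝟙 (A u w)
  f-pair u w with u ≟ w
  ... | yes refl rewrite ltB-irrefl (toℕ u) | A-irrefl u = refl
  ... | no u≢w   rewrite A-sym w u = ltB-split (toℕ u) (toℕ w) (u≢w ∘ toℕ-injective) (A u w)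

halve-≤ : ∀ {a b d} → 1 ≤ d → a + a + (d ∸ 1) ≤ b + b + d → a ≤ b
halve-≤ {a} {b} {suc d} _ ≤d =
  double-≤ a b (+-cancelʳ-≤ d (a + a) (suc (b + b)) (≤-trans ≤d (≤-reflexive (+-suc (b + b) d))))
  where
  double-≤ : ∀ a b → a + a ≤ suc (b + b) → a ≤ b
  double-≤ a b a+a≤ = ≮⇒≥ λ b<a →
    n≮n (b + b) (subst (_≤ b + b) (+-suc b b) (≤-pred (≤-trans (+-mono-≤ b<a b<a) a+a≤)))

*-odd : ∀ d q → d * suc (q * 2) ≡ d * q + d * q + d
*-odd = solve-∀

odd/2 : ∀ q → suc (q * 2) / 2 ≡ q
odd/2 q = trans (+-distrib-/-∣ʳ 1 {d = 2} (divides-refl q)) (m*n/n≡m q 2)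

module _ {n : ℕ} (G : Graph n) where

  deg≤Δ : ∀ u → deg G u ≤ Δ G
  deg≤Δ = maxFin-upper (deg G)

  degIn≤deg : ∀ S u → degIn G S u ≤ deg G u
  degIn≤deg S u = count-mono (λ w → ∧-true-right (S w))
    where
    ∧-true-right : ∀ a {b} → a ∧ b ≡ true → b ≡ true
    ∧-true-right true b≡true = b≡true

  -- ΔIn G S is definitionally maxFin (inducedDeg S).
  inducedDeg : (Fin n → Bool) → Fin n → ℕ
  inducedDeg S u = if S u then degIn G S u else 0

  handshake-induced : ∀ S → edgesIn G S + edgesIn G S ≡ sum (inducedDeg S)
  handshake-induced S = begin
    edgesIn G S + edgesIn G S                          ≡⟨ cong₂ _+_ edges≡ edges≡ ⟩
    orderedPairCount inducedAdj + orderedPairCount inducedAdj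
                                                       ≡⟨ handshake inducedAdj inducedAdj-sym inducedAdj-irrefl ⟩
    sum (λ u → count (inducedAdj u))                   ≡⟨ sum-cong-≗ count-inducedAdj ⟩
    sum (inducedDeg S)                                 ∎
    where
    open ≡-Reasoning
    inducedAdj : Fin n → Fin n → Bool
    inducedAdj u w = S u ∧ (S w ∧ adj G u w)

    inducedAdj-sym : ∀ u w → inducedAdj u w ≡ inducedAdj w u
    inducedAdj-sym u w rewrite Graph.sym G u w = begin
      S u ∧ (S w ∧ adj G w u)   ≡⟨ ∧-assoc (S u) (S w) _ ⟨
      (S u ∧ S w) ∧ adj G w u   ≡⟨ cong (_∧ adj G w u) (∧-comm (S u) (S w)) ⟩
      (S w ∧ S u) ∧ adj G w u   ≡⟨ ∧-assoc (S w) (S u) _ ⟩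
      S w ∧ (S u ∧ adj G w u)   ∎

    inducedAdj-irrefl : ∀ u → inducedAdj u u ≡ false
    inducedAdj-irrefl u rewrite irrefl G u = trans (cong (S u ∧_) (∧-zeroʳ (S u))) (∧-zeroʳ (S u))

    count-inducedAdj : ∀ u → count (inducedAdj u) ≡ inducedDeg S u
    count-inducedAdj u with S u
    ... | true  = refl
    ... | false = count-false {n}

    edges≡ : edgesIn G S ≡ orderedPairCount inducedAdj
    edges≡ = sumFin≡sum (λ u → count (λ w → ltB (toℕ u) (toℕ w) ∧ inducedAdj u w))

  degIn≤ΔIn : ∀ S u → S u ≡ true → degIn G S u ≤ ΔIn G S
  degIn≤ΔIn S u u∈S = subst (_≤ ΔIn G S) inducedDeg-u (maxFin-upper (inducedDeg S) u)
    where
    inducedDeg-u : inducedDeg S u ≡ degIn G S u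
    inducedDeg-u rewrite u∈S = refl

  degreeSum-bound : ∀ S u → S u ≡ true → sum (inducedDeg S) + (Δ G ∸ deg G u) ≤ Δ G * count S
  degreeSum-bound S u u∈S = begin
    sum (inducedDeg S) + (Δ G ∸ deg G u)      ≤⟨ sum-mono-≤-slack u inducedDeg≤Δ slack ⟩
    sum (λ w → if S w then Δ G else 0)        ≡⟨ sum-if≡*count (Δ G) S ⟩
    Δ G * count S                             ∎
    where
    open ≤-Reasoning
    inducedDeg≤Δ : ∀ w → inducedDeg S w ≤ (if S w then Δ G else 0)
    inducedDeg≤Δ w with S w
    ... | true  = ≤-trans (degIn≤deg S w) (deg≤Δ w)
    ... | false = z≤n

    slack : inducedDeg S u + (Δ G ∸ deg G u) ≤ (if S u then Δ G else 0)
    slack rewrite u∈S = begin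
      degIn G S u + (Δ G ∸ deg G u)   ≤⟨ +-monoˡ-≤ _ (degIn≤deg S u) ⟩
      deg G u + (Δ G ∸ deg G u)       ≡⟨ m+[n∸m]≡n (deg≤Δ u) ⟩
      Δ G                             ∎

  module _ (v : Fin n) where

    adj⇒∈closedNbhd : ∀ u → Adj G v u → closedNbhd G v u ≡ true
    adj⇒∈closedNbhd u v~u rewrite v~u = refl

    closedNbhd-size : count (closedNbhd G v) ≡ suc (deg G v)
    closedNbhd-size = begin
      count (closedNbhd G v)                               ≡⟨ count-∨-disjoint (adj G v) (λ w → does (v ≟ w)) disjoint ⟩
      deg G v + count (λ w → does (v ≟ w))                 ≡⟨ cong (deg G v +_) (count-≟ v) ⟩
      deg G v + 1                                          ≡⟨ +-comm (deg G v) 1 ⟩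
      suc (deg G v)                                        ∎
      where
      open ≡-Reasoning
      disjoint : ∀ w → adj G v w ∧ does (v ≟ w) ≡ false
      disjoint w with v ≟ w
      ... | yes refl = cong (_∧ true) (irrefl G v)
      ... | no  _    = ∧-zeroʳ (adj G v w)

    deg≤ΔIn-closedNbhd : deg G v ≤ ΔIn G (closedNbhd G v)
    deg≤ΔIn-closedNbhd =
      subst (_≤ ΔIn G (closedNbhd G v)) degIn-centre (degIn≤ΔIn (closedNbhd G v) v centre∈)
      where
      centre∈ : closedNbhd G v v ≡ true
      centre∈ rewrite irrefl G v with v ≟ v
      ... | yes _   = refl
      ... | no v≢v  = ⊥-elim (v≢v refl)

      degIn-centre : degIn G (closedNbhd G v) v ≡ deg G v
      degIn-centre = count-cong (λ w → trans (∧-comm (closedNbhd G v w) _) (∧-abs-∨ (adj G v w) _))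

lemma1 : {n : ℕ} (G : Graph n) (inX : Fin n → Bool) →
         Connected G → SplitPartition G inX → StretchIndex G 2 →
         2 ∣ Δ G → (v : Fin n) → deg G v ≡ Δ G →
         OverfullIn G (closedNbhd G v) →
         ∀ u → Adj G v u → deg G u ≢ 1
lemma1 G _ _ _ _ (divides q Δ≡q*2) v deg-v≡Δ overfull u v~u deg-u≡1 =
  <⇒≱ edges-lower (halve-≤ Δ≥1 edges-upper)
  where
  open ≤-Reasoning
  S = closedNbhd G v
  E = edgesIn G S
  D = Δ G

  |S|≡2q+1 : count S ≡ suc (q * 2)
  |S|≡2q+1 = trans (closedNbhd-size G v) (cong suc (trans deg-v≡Δ Δ≡q*2))

  Δ≥1 : 1 ≤ D
  Δ≥1 = subst (_≤ D) deg-u≡1 (deg≤Δ G u)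

  edges-lower : D * q < E
  edges-lower = begin-strict
    D * q                    ≤⟨ *-monoˡ-≤ q (subst (_≤ ΔIn G S) deg-v≡Δ (deg≤ΔIn-closedNbhd G v)) ⟩
    ΔIn G S * q              ≡⟨ cong (ΔIn G S *_) (trans (cong (_/ 2) |S|≡2q+1) (odd/2 q)) ⟨
    ΔIn G S * (count S / 2)  <⟨ overfull ⟩
    E                        ∎

  edges-upper : E + E + (D ∸ 1) ≤ D * q + D * q + D
  edges-upper = begin
    E + E + (D ∸ 1)          ≡⟨ cong₂ _+_ (handshake-induced G S) (cong (D ∸_) (≡-sym deg-u≡1)) ⟩
    sum (inducedDeg G S) + (D ∸ deg G u)
                             ≤⟨ degreeSum-bound G S u (adj⇒∈closedNbhd G v u v~u) ⟩
    D * count S              ≡⟨ cong (D *_) |S|≡2q+1 ⟩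
    D * suc (q * 2)          ≡⟨ *-odd D q ⟩
    D * q + D * q + D        ∎
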